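{- Let $m\geq0$ and $n\geq1$ be integers and let $a=(a_{ij})_{1\leq i,j\leq 2(n+m)}$ be (the height array of) an element of $\mathcal{S}_{n,m}$. Associate to $a$ the array $c=(c_{ij})_{1\leq i,j\leq n+m}$ with $c_{ij}=\max\{a_{i+n+m,j}-(n+m)-i+1,\,0\}$ (i.e. zero and negative entries are ignored). Then $c$ is a plane partition belonging to $\mathcal{C}_{n,m}$, and this map is a bijection of $\mathcal{S}_{n,m}$ onto $\mathcal{C}_{n,m}$.
   Context: A plane partition is identified with its Ferrers graph, a finite set $\pi\subset\mathbb{P}^3$ that is closed downward in each coordinate; its height array is $a_{ij}=\#\{z:(i,j,z)\in\pi\}$. Let $M=n+m$. A totally symmetric self-complementary plane partition of size $M$ is a plane partition $\pi\subseteq[2M]^3$ invariant under all permutations of coordinates with $(x,y,z)\in\pi$ iff $(2M+1-x,2M+1-y,2M+1-z)\notin\pi$ for all $(x,y,z)\in[2M]^3$. $\mathcal{S}_{n,m}$ is the set of such $\pi$ satisfying: every $(x,y,z)\in\pi$ with $n+1\leq x,y,z\leq n+2m$ has at least two of its coordinates $\leq n+m$. $\mathcal{C}_{n,m}$ is the set of plane partitions $c=(c_{ij})_{i,j\geq1}$ (arrays of nonnegative integers with finitely many nonzero entries, weakly decreasing along rows and columns) that have at most $n$ nonzero columns, whose nonzero entries are strictly decreasing down each column, and such that each nonzero entry in column $j$ is at most $n+m-j$. -}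

module Defs where

open import Data.Nat using (ℕ; zero; suc; _+_; _*_; _∸_; _≤_; _<_; _≤ᵇ_)
open import Data.Bool using (if_then_else_; _∧_)
open import Data.Product using (_×_; ∃)
open import Data.Sum using (_⊎_)
open import Relation.Nullary using (¬_)
open import Relation.Binary.PropositionalEquality using (_≡_; _≢_)
open import Function.Bundles using (_⇔_)

-- All indices are 1-based natural numbers, as in the paper.
-- A plane partition π ⊆ [N]^3 (N = 2M) is represented by its height
-- array a : ℕ → ℕ → ℕ; only the entries a x y with 1 ≤ x,y ≤ N matter.

InBox : ℕ → ℕ → Set
InBox N x = 1 ≤ x × x ≤ N

Mem : ℕ → (ℕ → ℕ → ℕ) → ℕ → ℕ → ℕ → Set
Mem N a x y z = InBox N x × InBox N y × 1 ≤ z × z ≤ a x y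

IsPPInBox : ℕ → (ℕ → ℕ → ℕ) → Set
IsPPInBox N a =
  (∀ x y z x′ y′ z′ → Mem N a x y z →
     1 ≤ x′ → x′ ≤ x → 1 ≤ y′ → y′ ≤ y → 1 ≤ z′ → z′ ≤ z →
     Mem N a x′ y′ z′)
  × (∀ x y z → Mem N a x y z → z ≤ N)

TotallySymmetric : ℕ → (ℕ → ℕ → ℕ) → Set
TotallySymmetric N a = ∀ x y z → Mem N a x y z →
  Mem N a x z y × Mem N a y x z × Mem N a y z x × Mem N a z x y × Mem N a z y x

SelfComplementary : ℕ → (ℕ → ℕ → ℕ) → Set
SelfComplementary N a = ∀ x y z → InBox N x → InBox N y → InBox N z →
  Mem N a x y z ⇔ (¬ Mem N a (suc N ∸ x) (suc N ∸ y) (suc N ∸ z))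

IsTSSCPP : ℕ → (ℕ → ℕ → ℕ) → Set
IsTSSCPP M a = IsPPInBox (2 * M) a × TotallySymmetric (2 * M) a
             × SelfComplementary (2 * M) a

InS : ℕ → ℕ → (ℕ → ℕ → ℕ) → Set
InS n m a = IsTSSCPP (n + m) a ×
  (∀ x y z → Mem (2 * (n + m)) a x y z →
     suc n ≤ x → x ≤ n + 2 * m →
     suc n ≤ y → y ≤ n + 2 * m →
     suc n ≤ z → z ≤ n + 2 * m →
     (x ≤ n + m × y ≤ n + m) ⊎ (x ≤ n + m × z ≤ n + m) ⊎ (y ≤ n + m × z ≤ n + m))

-- Plane partitions c = (c i j)_{i,j ≥ 1} (entries at index 0 are ignored).

IsPlanePartition : (ℕ → ℕ → ℕ) → Set
IsPlanePartition c =
  (∀ i j → 1 ≤ i → 1 ≤ j → c i (suc j) ≤ c i j)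
  × (∀ i j → 1 ≤ i → 1 ≤ j → c (suc i) j ≤ c i j)
  × ∃ λ B → ∀ i j → 1 ≤ i → 1 ≤ j → c i j ≢ 0 → i ≤ B × j ≤ B

InC : ℕ → ℕ → (ℕ → ℕ → ℕ) → Set
InC n m c = IsPlanePartition c
  -- at most n nonzero columns (nonzero columns of a plane partition
  -- form an initial segment 1..k, so this says every nonzero entry is
  -- in a column j ≤ n)
  × (∀ i j → 1 ≤ i → 1 ≤ j → c i j ≢ 0 → j ≤ n)
  × (∀ i j → 1 ≤ i → 1 ≤ j → c (suc i) j ≢ 0 → c (suc i) j < c i j)
  × (∀ i j → 1 ≤ i → 1 ≤ j → c i j ≢ 0 → c i j + j ≤ n + m)

-- The map a ↦ c :
--   c i j = max{ a (i+M) j - M - i + 1 , 0 }  for 1 ≤ i,j ≤ M  (M = n+m),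
--   c i j = 0 otherwise.
-- In ℕ, max{x - M - i + 1, 0} = x ∸ (M + (i ∸ 1)) for i ≥ 1.
toC : ℕ → ℕ → (ℕ → ℕ → ℕ) → ℕ → ℕ → ℕ
toC n m a i j =
  if (1 ≤ᵇ i) ∧ (i ≤ᵇ (n + m)) ∧ (1 ≤ᵇ j) ∧ (j ≤ᵇ (n + m))
  then a (i + (n + m)) j ∸ ((n + m) + (i ∸ 1))
  else 0

{-# OPTIONS --safe #-}
-- Split [2M] into a lower half [1, M] and an upper half [M + 1, 2M].  A TSSCPP π contains the
-- lower cube [M]³ (if it missed (M, M, M) it would contain the complementary cell (M+1, M+1, M+1)),
-- misses the upper cube, and a cell with exactly one upper coordinate lies in π iff its
-- complement, which has two, does not.  By total symmetry π is therefore determined by its cells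
-- (M + u, s, M + v) with u ≤ v, and such a cell lies in π iff v < u + c u s, because row M + u of
-- π has height M + u - 1 + c u s in column s.  This gives injectivity.  Conversely, for c ∈ C put
-- (M + u, s, M + v) into π iff v < u + c u s and u < v + c v s, and extend by the two rules above:
-- the strict decrease down the columns of c and the bound c i j + j ≤ n + m are exactly what makes
-- the result downward closed, and "at most n nonzero columns" is the S-condition.  Read backwards,
-- the S-condition and self-complementarity put the image of every element of S into C.
module Submission where

open import Defs
open import Data.Nat using (ℕ; zero; suc; _+_; _*_; _∸_; _≤_; _<_; z≤n; s≤s; _≤?_; _<?_; _≟_; _≤ᵇ_)
open import Data.Nat.Properties
open import Data.Bool using (T; true; false)
open import Data.Bool.Properties using (T-≡)
open import Data.Product using (_×_; _,_; proj₁; proj₂; ∃; swap)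
open import Data.Sum using (_⊎_; inj₁; inj₂; [_,_]′)
open import Data.Unit using (⊤; tt)
open import Data.Empty using (⊥; ⊥-elim)
open import Function.Base using (id; _∘′_)
open import Function.Bundles using (_⇔_; mk⇔; Equivalence)
open import Relation.Nullary using (¬_; Dec; yes; no; contradiction)
open import Relation.Nullary.Decidable using (_×-dec_; ¬?; decidable-stable)
open import Relation.Binary.PropositionalEquality

open Equivalence using (to; from)

2*m≡m+m : ∀ m → 2 * m ≡ m + m
2*m≡m+m m = cong (m +_) (+-identityʳ m)

1≤1+m∸n : ∀ {m n} → n ≤ m → 1 ≤ suc m ∸ n
1≤1+m∸n n≤m = m<n⇒0<n∸m (s≤s n≤m)

m∸[1+o]<n∸o : ∀ {m n o} → m ∸ suc o ≢ 0 → m ≤ n → m ∸ suc o < n ∸ o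
m∸[1+o]<n∸o {o = o} m∸[1+o]≢0 m≤n =
  <-≤-trans (∸-monoʳ-< (n<1+n o) (<⇒≤ (m∸n≢0⇒n<m m∸[1+o]≢0))) (∸-monoˡ-≤ o m≤n)

1≤m⇒1+[n+m]≤n+2m : ∀ {n m} → 1 ≤ m → suc (n + m) ≤ n + 2 * m
1≤m⇒1+[n+m]≤n+2m {n} {m} 1≤m = begin
  suc (n + m)  ≡⟨ +-suc n m ⟨
  n + suc m    ≡⟨ cong (n +_) (+-comm 1 m) ⟩
  n + (m + 1)  ≤⟨ +-monoʳ-≤ n (+-monoʳ-≤ m 1≤m) ⟩
  n + (m + m)  ≡⟨ cong (n +_) (2*m≡m+m m) ⟨
  n + 2 * m    ∎
  where open ≤-Reasoning

≡0⇒≤ : ∀ {x y} → x ≡ 0 → x ≤ y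
≡0⇒≤ refl = z≤n

≤∸⇒+≤ : ∀ {k h d} → 1 ≤ k → k ≤ h ∸ d → d + k ≤ h
≤∸⇒+≤ {k} {h} {d} 1≤k k≤h∸d = subst (_≤ h) (+-comm k d) (m≤o∸n⇒m+n≤o k d≤h k≤h∸d)
  where
  d≤h : d ≤ h
  d≤h = <⇒≤ (m∸n≢0⇒n<m (m<n⇒n≢0 (≤-trans 1≤k k≤h∸d)))

+[1+m∸k]≤m⇒< : ∀ {m k v} → k ≤ m → v + (suc m ∸ k) ≤ m → v < k
+[1+m∸k]≤m⇒< {m} {k} {v} k≤m le = +-cancelʳ-≤ (m ∸ k) (suc v) k (begin
  suc v + (m ∸ k)  ≡⟨ sym (+-suc v (m ∸ k)) ⟩
  v + suc (m ∸ k)  ≡⟨ cong (v +_) (sym (+-∸-assoc 1 k≤m)) ⟩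
  v + (suc m ∸ k)  ≤⟨ le ⟩
  m                ≡⟨ sym (m+[n∸m]≡n k≤m) ⟩
  k + (m ∸ k)      ∎)
  where open ≤-Reasoning

complement-inBox : ∀ {N x} → InBox N x → InBox N (suc N ∸ x)
complement-inBox {N} (1≤x , x≤N) = 1≤1+m∸n x≤N , ∸-monoʳ-≤ (suc N) 1≤x

complement-upper : ∀ M {x} → M < x → suc (2 * M) ∸ x ≤ M
complement-upper M {x} M<x = begin
  suc (2 * M) ∸ x  ≤⟨ ∸-monoʳ-≤ (suc (2 * M)) M<x ⟩
  2 * M ∸ M        ≡⟨ cong (_∸ M) (2*m≡m+m M) ⟩
  M + M ∸ M        ≡⟨ m+n∸n≡m M M ⟩
  M                ∎
  where open ≤-Reasoning

complement-lower : ∀ M {x} → x ≤ M → M < suc (2 * M) ∸ x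
complement-lower M {x} x≤M = begin-strict
  M                <⟨ n<1+n M ⟩
  suc M            ≡⟨ sym (m+n∸n≡m (suc M) M) ⟩
  suc (M + M) ∸ M  ≡⟨ cong (λ t → suc t ∸ M) (sym (2*m≡m+m M)) ⟩
  suc (2 * M) ∸ M  ≤⟨ ∸-monoʳ-≤ (suc (2 * M)) x≤M ⟩
  suc (2 * M) ∸ x  ∎
  where open ≤-Reasoning

DownwardClosed : (ℕ → Set) → ℕ → Set
DownwardClosed P K = ∀ {z z′} → 1 ≤ z′ → z′ ≤ z → z ≤ K → P z → P z′

module _ {P : ℕ → Set} (P? : ∀ z → Dec (P z)) where

  count : ℕ → ℕ
  count zero = 0
  count (suc K) with P? (suc K)
  ... | yes _ = suc (count K)
  ... | no _  = count K

  count≤ : ∀ K → count K ≤ K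
  count≤ zero = z≤n
  count≤ (suc K) with P? (suc K)
  ... | yes _ = s≤s (count≤ K)
  ... | no _  = m≤n⇒m≤1+n (count≤ K)

  count-all : ∀ K → (∀ {z} → 1 ≤ z → z ≤ K → P z) → count K ≡ K
  count-all zero _ = refl
  count-all (suc K) all with P? (suc K)
  ... | yes _  = cong suc (count-all K (λ 1≤z z≤K → all 1≤z (m≤n⇒m≤1+n z≤K)))
  ... | no ¬PK = contradiction (all (s≤s z≤n) ≤-refl) ¬PK

  ≤count⇔ : ∀ K → DownwardClosed P K → ∀ {z} → 1 ≤ z → z ≤ K → (z ≤ count K ⇔ P z)
  ≤count⇔ zero _ 1≤z z≤0 = contradiction (≤-trans 1≤z z≤0) λ ()
  ≤count⇔ (suc K) down {z} 1≤z z≤1+K with P? (suc K)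
  ... | yes PK = mk⇔ (λ _ → down 1≤z z≤1+K ≤-refl PK)
                     (λ _ → subst (z ≤_) (cong suc (sym (count-all K below))) z≤1+K)
    where
    below : ∀ {y} → 1 ≤ y → y ≤ K → P y
    below 1≤y y≤K = down 1≤y (m≤n⇒m≤1+n y≤K) ≤-refl PK
  ... | no ¬PK with m≤n⇒m<n∨m≡n z≤1+K
  ...   | inj₂ refl = mk⇔ (λ 1+K≤count → contradiction (count≤ K) (<⇒≱ 1+K≤count))
                          (λ PK → contradiction PK ¬PK)
  ...   | inj₁ (s≤s z≤K) =
    ≤count⇔ K (λ 1≤z′ z′≤z z≤K′ → down 1≤z′ z′≤z (m≤n⇒m≤1+n z≤K′)) 1≤z z≤K

-- x ≤ M is encoded as lower (M + 1 - x) and x > M as upper (x - M), so that the complement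
-- x ↦ 2M + 1 - x becomes mirror.
data Coord : Set where
  lower upper : ℕ → Coord

offset : Coord → ℕ
offset (lower k) = k
offset (upper k) = k

mirror : Coord → Coord
mirror (lower k) = upper k
mirror (upper k) = lower k

_≼_ : Coord → Coord → Set
lower a  ≼ lower b  = b ≤ a
lower _  ≼ upper _ = ⊤
upper _ ≼ lower _  = ⊥
upper a ≼ upper b = a ≤ b

module Coordinates (M : ℕ) where

  encode : ℕ → Coord
  encode x with x ≤? M
  ... | yes _ = lower (suc M ∸ x)
  ... | no _  = upper (x ∸ M)

  encode-lower : ∀ {x} → x ≤ M → encode x ≡ lower (suc M ∸ x)
  encode-lower {x} x≤M with x ≤? M
  ... | yes _   = refl
  ... | no x≰M = contradiction x≤M x≰M

  encode-upper : ∀ {x} → M < x → encode x ≡ upper (x ∸ M)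
  encode-upper {x} M<x with x ≤? M
  ... | yes x≤M = contradiction x≤M (<⇒≱ M<x)
  ... | no _    = refl

  encode-inBox : ∀ {x} → InBox (2 * M) x → InBox M (offset (encode x))
  encode-inBox {x} (1≤x , x≤2M) with x ≤? M
  ... | yes x≤M = 1≤1+m∸n x≤M , ∸-monoʳ-≤ (suc M) 1≤x
  ... | no x≰M  = m<n⇒0<n∸m (≰⇒> x≰M)
                , m≤n+o⇒m∸n≤o x M (subst (x ≤_) (2*m≡m+m M) x≤2M)

  encode-mono : ∀ {x′ x} → x′ ≤ x → encode x′ ≼ encode x
  encode-mono {x′} {x} x′≤x with x′ ≤? M | x ≤? M
  ... | yes _    | yes _   = ∸-monoʳ-≤ (suc M) x′≤x
  ... | yes _    | no _    = tt
  ... | no x′≰M  | yes x≤M = x′≰M (≤-trans x′≤x x≤M)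
  ... | no _     | no _    = ∸-monoˡ-≤ M x′≤x

  encode-complement : ∀ {x} → InBox (2 * M) x → encode (suc (2 * M) ∸ x) ≡ mirror (encode x)
  encode-complement {x} (1≤x , x≤2M) with x ≤? M
  ... | yes x≤M = begin
    encode (suc (2 * M) ∸ x)     ≡⟨ encode-upper (complement-lower M x≤M) ⟩
    upper (suc (2 * M) ∸ x ∸ M)  ≡⟨ cong (λ t → upper (suc t ∸ x ∸ M)) (2*m≡m+m M) ⟩
    upper (suc M + M ∸ x ∸ M)    ≡⟨ cong (λ t → upper (t ∸ M)) (+-∸-comm M (m≤n⇒m≤1+n x≤M)) ⟩
    upper (suc M ∸ x + M ∸ M)    ≡⟨ cong upper (m+n∸n≡m (suc M ∸ x) M) ⟩
    upper (suc M ∸ x)            ∎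
    where open ≡-Reasoning
  ... | no x≰M = begin
    encode (suc (2 * M) ∸ x)           ≡⟨ encode-lower (complement-upper M M<x) ⟩
    lower (suc M ∸ (suc (2 * M) ∸ x))  ≡⟨ cong (λ t → lower (suc M ∸ t)) complement≡ ⟩
    lower (suc M ∸ (suc M ∸ (x ∸ M)))  ≡⟨ cong lower (m∸[m∸n]≡n (m≤n⇒m≤1+n x∸M≤M)) ⟩
    lower (x ∸ M)                      ∎
    where
    open ≡-Reasoning
    M<x : M < x
    M<x = ≰⇒> x≰M
    x∸M≤M : x ∸ M ≤ M
    x∸M≤M = m≤n+o⇒m∸n≤o x M (subst (x ≤_) (2*m≡m+m M) x≤2M)
    complement≡ : suc (2 * M) ∸ x ≡ suc M ∸ (x ∸ M)
    complement≡ = begin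
      suc (2 * M) ∸ x            ≡⟨ cong (λ t → suc t ∸ x) (2*m≡m+m M) ⟩
      suc M + M ∸ x              ≡⟨ cong₂ _∸_ (+-comm (suc M) M) (sym (m+[n∸m]≡n (<⇒≤ M<x))) ⟩
      M + suc M ∸ (M + (x ∸ M))  ≡⟨ [m+n]∸[m+o]≡n∸o M (suc M) (x ∸ M) ⟩
      suc M ∸ (x ∸ M)            ∎

-- A cell with one upper coordinate lies in the partition iff its mirror image, which has two, does not.
Cell : (ℕ → ℕ → ℕ → Set) → Coord → Coord → Coord → Set
Cell R (lower _) (lower _) (lower _) = ⊤
Cell R (upper a) (lower b) (lower c) = ¬ R b c a
Cell R (lower a) (upper b) (lower c) = ¬ R a c b
Cell R (lower a) (lower b) (upper c) = ¬ R a b c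
Cell R (upper a) (upper b) (lower c) = R a b c
Cell R (upper a) (lower b) (upper c) = R a c b
Cell R (lower a) (upper b) (upper c) = R b c a
Cell R (upper _) (upper _) (upper _) = ⊥

record IsUpperRelation (M : ℕ) (R : ℕ → ℕ → ℕ → Set) : Set where
  field
    symmetric : ∀ {u v k} → R u v k → R v u k
    antitone  : ∀ {u u′ v k} → InBox M u → InBox M u′ → InBox M v → InBox M k →
                u′ ≤ u → R u v k → R u′ v k
    monotone  : ∀ {u v k k′} → InBox M u → InBox M v → InBox M k → InBox M k′ →
                k ≤ k′ → R u v k → R u v k′
    -- needed for downward closure when an upper first coordinate is moved into the lower half
    exclusive : ∀ {u v k t} → InBox M u → InBox M v → InBox M k → InBox M t →
                R u v k → ¬ R t k v
    decidable : ∀ u v k → Dec (R u v k)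

module UpperRelation {M : ℕ} {R : ℕ → ℕ → ℕ → Set} (isR : IsUpperRelation M R) where
  open IsUpperRelation isR

  Valid : Coord → Set
  Valid p = InBox M (offset p)

  Cell? : ∀ p q r → Dec (Cell R p q r)
  Cell? (lower _) (lower _) (lower _) = yes tt
  Cell? (upper a) (lower b) (lower c) = ¬? (decidable b c a)
  Cell? (lower a) (upper b) (lower c) = ¬? (decidable a c b)
  Cell? (lower a) (lower b) (upper c) = ¬? (decidable a b c)
  Cell? (upper a) (upper b) (lower c) = decidable a b c
  Cell? (upper a) (lower b) (upper c) = decidable a c b
  Cell? (lower a) (upper b) (upper c) = decidable b c a
  Cell? (upper _) (upper _) (upper _) = no λ ()

  Cell-swap₁₂ : ∀ p q r → Cell R p q r → Cell R q p r
  Cell-swap₁₂ (lower _) (lower _) (lower _) _   = tt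
  Cell-swap₁₂ (upper _) (lower _) (lower _) ¬r  = ¬r
  Cell-swap₁₂ (lower _) (upper _) (lower _) ¬r  = ¬r
  Cell-swap₁₂ (lower _) (lower _) (upper _) ¬r  = ¬r ∘′ symmetric
  Cell-swap₁₂ (upper _) (upper _) (lower _) r   = symmetric r
  Cell-swap₁₂ (upper _) (lower _) (upper _) r   = r
  Cell-swap₁₂ (lower _) (upper _) (upper _) r   = r
  Cell-swap₁₂ (upper _) (upper _) (upper _) ()

  Cell-swap₂₃ : ∀ p q r → Cell R p q r → Cell R p r q
  Cell-swap₂₃ (lower _) (lower _) (lower _) _   = tt
  Cell-swap₂₃ (upper _) (lower _) (lower _) ¬r  = ¬r ∘′ symmetric
  Cell-swap₂₃ (lower _) (upper _) (lower _) ¬r  = ¬r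
  Cell-swap₂₃ (lower _) (lower _) (upper _) ¬r  = ¬r
  Cell-swap₂₃ (upper _) (upper _) (lower _) r   = r
  Cell-swap₂₃ (upper _) (lower _) (upper _) r   = r
  Cell-swap₂₃ (lower _) (upper _) (upper _) r   = symmetric r
  Cell-swap₂₃ (upper _) (upper _) (upper _) ()

  Cell-antitone₁ : ∀ p p′ q r → Valid p → Valid p′ → Valid q → Valid r →
                   p′ ≼ p → Cell R p q r → Cell R p′ q r
  Cell-antitone₁ (lower _) (lower _) (lower _) (lower _) _  _   _  _  _  _   = tt
  Cell-antitone₁ (upper _) (lower _) (lower _) (lower _) _  _   _  _  _  _   = tt
  Cell-antitone₁ (upper _) (upper _) (lower _) (lower _) vp vp′ vq vr le ¬r =
    ¬r ∘′ monotone vq vr vp′ vp le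
  Cell-antitone₁ (lower _) (lower _) (upper _) (lower _) vp vp′ vq vr le ¬r =
    ¬r ∘′ antitone vp′ vp vr vq le
  Cell-antitone₁ (upper _) (lower _) (upper _) (lower _) vp vp′ vq vr _  r  =
    exclusive vp vq vr vp′ r
  Cell-antitone₁ (upper _) (upper _) (upper _) (lower _) vp vp′ vq vr le r  =
    antitone vp vp′ vq vr le r
  Cell-antitone₁ (lower _) (lower _) (lower _) (upper _) vp vp′ vq vr le ¬r =
    ¬r ∘′ antitone vp′ vp vq vr le
  Cell-antitone₁ (upper _) (lower _) (lower _) (upper _) vp vp′ vq vr _  r  =
    exclusive vp vr vq vp′ r
  Cell-antitone₁ (upper _) (upper _) (lower _) (upper _) vp vp′ vq vr le r  =
    antitone vp vp′ vr vq le r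
  Cell-antitone₁ (lower _) (lower _) (upper _) (upper _) vp vp′ vq vr le r  =
    monotone vq vr vp vp′ le r
  Cell-antitone₁ (lower _) (upper _) _         _         _  _   _  _  ()
  Cell-antitone₁ (upper _) _         (upper _) (upper _) _  _   _  _  _  ()

  Cell⇒¬Cell-mirror : ∀ p q r → Cell R p q r → ¬ Cell R (mirror p) (mirror q) (mirror r)
  Cell⇒¬Cell-mirror (lower _) (lower _) (lower _) _   ()
  Cell⇒¬Cell-mirror (upper _) (lower _) (lower _) ¬r  r  = ¬r r
  Cell⇒¬Cell-mirror (lower _) (upper _) (lower _) ¬r  r  = ¬r r
  Cell⇒¬Cell-mirror (lower _) (lower _) (upper _) ¬r  r  = ¬r r
  Cell⇒¬Cell-mirror (upper _) (upper _) (lower _) r   ¬r = ¬r r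
  Cell⇒¬Cell-mirror (upper _) (lower _) (upper _) r   ¬r = ¬r r
  Cell⇒¬Cell-mirror (lower _) (upper _) (upper _) r   ¬r = ¬r r
  Cell⇒¬Cell-mirror (upper _) (upper _) (upper _) ()

  ¬Cell-mirror⇒Cell : ∀ p q r → ¬ Cell R (mirror p) (mirror q) (mirror r) → Cell R p q r
  ¬Cell-mirror⇒Cell (lower _) (lower _) (lower _) _      = tt
  ¬Cell-mirror⇒Cell (upper _) (lower _) (lower _) ¬r     = ¬r
  ¬Cell-mirror⇒Cell (lower _) (upper _) (lower _) ¬r     = ¬r
  ¬Cell-mirror⇒Cell (lower _) (lower _) (upper _) ¬r     = ¬r
  ¬Cell-mirror⇒Cell (upper a) (upper b) (lower c) ¬¬r    = decidable-stable (decidable a b c) ¬¬r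
  ¬Cell-mirror⇒Cell (upper a) (lower b) (upper c) ¬¬r    = decidable-stable (decidable a c b) ¬¬r
  ¬Cell-mirror⇒Cell (lower a) (upper b) (upper c) ¬¬r    = decidable-stable (decidable b c a) ¬¬r
  ¬Cell-mirror⇒Cell (upper _) (upper _) (upper _) ¬true  = ⊥-elim (¬true tt)

module UpperRelationOfC (n m : ℕ) (c : ℕ → ℕ → ℕ) (c∈C : InC n m c) where

  M : ℕ
  M = n + m

  row-step : ∀ i j → 1 ≤ i → 1 ≤ j → c i (suc j) ≤ c i j
  row-step = proj₁ (proj₁ c∈C)

  col≤n : ∀ i j → 1 ≤ i → 1 ≤ j → c i j ≢ 0 → j ≤ n
  col≤n = proj₁ (proj₂ c∈C)

  column-strict : ∀ i j → 1 ≤ i → 1 ≤ j → c (suc i) j ≢ 0 → c (suc i) j < c i j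
  column-strict = proj₁ (proj₂ (proj₂ c∈C))

  entry+col≤M : ∀ i j → 1 ≤ i → 1 ≤ j → c i j ≢ 0 → c i j + j ≤ M
  entry+col≤M = proj₂ (proj₂ (proj₂ c∈C))

  row-antitone : ∀ {i j j′} → 1 ≤ i → 1 ≤ j′ → j′ ≤ j → c i j ≤ c i j′
  row-antitone {i} {suc j} 1≤i 1≤j′ j′≤1+j with m≤n⇒m<n∨m≡n j′≤1+j
  ... | inj₂ refl       = ≤-refl
  ... | inj₁ (s≤s j′≤j) =
    ≤-trans (row-step i j 1≤i (≤-trans 1≤j′ j′≤j)) (row-antitone 1≤i 1≤j′ j′≤j)
  row-antitone {j = zero} 1≤i () z≤n

  entry+row-antitone : ∀ {i k s} → 1 ≤ i → i ≤ k → 1 ≤ s → c k s ≢ 0 → c k s + k ≤ c i s + i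
  entry+row-antitone {i} {suc k} {s} 1≤i i≤1+k 1≤s c≢0 with m≤n⇒m<n∨m≡n i≤1+k
  ... | inj₂ refl     = ≤-refl
  ... | inj₁ (s≤s i≤k) = begin
    c (suc k) s + suc k    ≡⟨ +-suc (c (suc k) s) k ⟩
    suc (c (suc k) s) + k  ≤⟨ +-monoˡ-≤ k c< ⟩
    c k s + k              ≤⟨ entry+row-antitone 1≤i i≤k 1≤s (m<n⇒n≢0 c<) ⟩
    c i s + i              ∎
    where
    open ≤-Reasoning
    c< : c (suc k) s < c k s
    c< = column-strict k s (≤-trans 1≤i i≤k) 1≤s c≢0
  entry+row-antitone {k = zero} () z≤n

  entry+row≤M : ∀ {i j} → 1 ≤ i → 1 ≤ j → c i j ≢ 0 → c i j + i ≤ M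
  entry+row≤M {i} {j} 1≤i 1≤j c≢0 = begin
    c i j + i  ≤⟨ entry+row-antitone ≤-refl 1≤i 1≤j c≢0 ⟩
    c 1 j + 1  ≤⟨ +-monoʳ-≤ (c 1 j) 1≤j ⟩
    c 1 j + j  ≤⟨ entry+col≤M 1 j ≤-refl 1≤j c₁≢0 ⟩
    M          ∎
    where
    open ≤-Reasoning
    c₁≢0 : c 1 j ≢ 0
    c₁≢0 c₁≡0 = <⇒≱ (+-mono-≤ (n≢0⇒n>0 c≢0) 1≤i)
                    (subst (λ t → c i j + i ≤ t + 1) c₁≡0 (entry+row-antitone ≤-refl 1≤i 1≤j c≢0))

  c-outside : ∀ {i j} → 1 ≤ i → 1 ≤ j → ¬ (i ≤ M × j ≤ M) → c i j ≡ 0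
  c-outside {i} {j} 1≤i 1≤j outside with c i j ≟ 0
  ... | yes c≡0 = c≡0
  ... | no c≢0  = contradiction (≤-trans (m≤n+m i (c i j)) (entry+row≤M 1≤i 1≤j c≢0) ,
                                 ≤-trans (col≤n i j 1≤i 1≤j c≢0) (m≤m+n n m)) outside

  UpperCell : ℕ → ℕ → ℕ → Set
  UpperCell u v s = v < c u s + u × u < c v s + v

  UpperCell-antitone : ∀ {u u′ v s} → 1 ≤ u′ → u′ ≤ u → 1 ≤ s → UpperCell u v s → UpperCell u′ v s
  UpperCell-antitone {u} {u′} {v} {s} 1≤u′ u′≤u 1≤s (v<cu+u , u<cv+v) =
    v<cu′+u′ , ≤-<-trans u′≤u u<cv+v
    where
    v<cu′+u′ : v < c u′ s + u′
    v<cu′+u′ with c u s ≟ 0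
    ... | no cu≢0 = <-≤-trans v<cu+u (entry+row-antitone 1≤u′ u′≤u 1≤s cu≢0)
    ... | yes cu≡0 with u′ ≤? v
    ...   | no u′≰v  = <-≤-trans (≰⇒> u′≰v) (m≤n+m u′ (c u′ s))
    ...   | yes u′≤v =
      <-trans v<u (<-≤-trans u<cv+v (entry+row-antitone 1≤u′ u′≤v 1≤s cv≢0))
      where
      v<u : v < u
      v<u = subst (λ t → v < t + u) cu≡0 v<cu+u
      cv≢0 : c v s ≢ 0
      cv≢0 cv≡0 = <-asym v<u (subst (λ t → u < t + v) cv≡0 u<cv+v)

  UpperCell-antitone-col : ∀ {u v s s′} → 1 ≤ u → 1 ≤ v → 1 ≤ s′ → s′ ≤ s →
                          UpperCell u v s → UpperCell u v s′
  UpperCell-antitone-col {u} {v} 1≤u 1≤v 1≤s′ s′≤s (v<cu+u , u<cv+v) =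
    <-≤-trans v<cu+u (+-monoˡ-≤ u (row-antitone 1≤u 1≤s′ s′≤s)) ,
    <-≤-trans u<cv+v (+-monoˡ-≤ v (row-antitone 1≤v 1≤s′ s′≤s))

  UpperCell⇒col≤n : ∀ {u v s} → 1 ≤ u → 1 ≤ v → 1 ≤ s → UpperCell u v s → s ≤ n
  UpperCell⇒col≤n {u} {v} {s} 1≤u 1≤v 1≤s (v<cu+u , u<cv+v) with c u s ≟ 0
  ... | no cu≢0  = col≤n u s 1≤u 1≤s cu≢0
  ... | yes cu≡0 = col≤n v s 1≤v 1≤s λ cv≡0 →
    <-asym (subst (λ t → v < t + u) cu≡0 v<cu+u) (subst (λ t → u < t + v) cv≡0 u<cv+v)

  UpperCell-row₁ : ∀ {v s} → 1 ≤ v → 1 ≤ s → UpperCell 1 v s → v + s ≤ M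
  UpperCell-row₁ {v} {s} 1≤v 1≤s (v<c+1 , _) =
    ≤-trans (+-monoˡ-≤ s v≤c) (entry+col≤M 1 s ≤-refl 1≤s c≢0)
    where
    v≤c : v ≤ c 1 s
    v≤c = ≤-pred (subst (v <_) (+-comm (c 1 s) 1) v<c+1)
    c≢0 : c 1 s ≢ 0
    c≢0 c≡0 = <⇒≱ 1≤v (subst (v ≤_) c≡0 v≤c)

  UpperCell-diagonal⇔ : ∀ {i k j} → 1 ≤ k → (UpperCell (suc i) (i + k) j ⇔ k ≤ c (suc i) j)
  UpperCell-diagonal⇔ {i} {k} {j} 1≤k = mk⇔ to′ from′
    where
    to′ : UpperCell (suc i) (i + k) j → k ≤ c (suc i) j
    to′ (i+k<c+1+i , _) = +-cancelʳ-≤ i k (c (suc i) j) (≤-pred (begin-strict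
      k + i                  ≡⟨ +-comm k i ⟩
      i + k                  <⟨ i+k<c+1+i ⟩
      c (suc i) j + suc i    ≡⟨ +-suc (c (suc i) j) i ⟩
      suc (c (suc i) j + i)  ∎))
      where open ≤-Reasoning
    from′ : k ≤ c (suc i) j → UpperCell (suc i) (i + k) j
    from′ k≤c = i+k<c+1+i , 1+i<c+i+ k 1≤k
      where
      i+k<c+1+i : i + k < c (suc i) j + suc i
      i+k<c+1+i = begin-strict
        i + k                  ≤⟨ +-monoʳ-≤ i k≤c ⟩
        i + c (suc i) j        ≡⟨ +-comm i (c (suc i) j) ⟩
        c (suc i) j + i        <⟨ n<1+n _ ⟩
        suc (c (suc i) j + i)  ≡⟨ +-suc (c (suc i) j) i ⟨
        c (suc i) j + suc i    ∎
        where open ≤-Reasoning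
      1+i<c+i+ : ∀ l → 1 ≤ l → suc i < c (i + l) j + (i + l)
      1+i<c+i+ 1 _ rewrite +-comm i 1 = +-monoˡ-≤ (suc i) (≤-trans 1≤k k≤c)
      1+i<c+i+ (suc (suc l)) _ rewrite +-suc i (suc l) | +-suc i l =
        ≤-trans (s≤s (s≤s (m≤m+n i l))) (m≤n+m _ (c (suc (suc (i + l))) j))

  UpperR : ℕ → ℕ → ℕ → Set
  UpperR u v k = UpperCell u v (suc M ∸ k)

  isUpperRelation : IsUpperRelation M UpperR
  isUpperRelation = record
    { symmetric = swap
    ; antitone  = λ _ (1≤u′ , _) _ (_ , k≤M) u′≤u →
                    UpperCell-antitone 1≤u′ u′≤u (1≤1+m∸n k≤M)
    ; monotone  = λ (1≤u , _) (1≤v , _) _ (_ , k′≤M) k≤k′ →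
                    UpperCell-antitone-col 1≤u 1≤v (1≤1+m∸n k′≤M) (∸-monoʳ-≤ (suc M) k≤k′)
    ; exclusive = exclusive
    ; decidable = λ u v k → (v <? _) ×-dec (u <? _)
    }
    where
    UpperR⇒< : ∀ {u v k} → InBox M u → InBox M v → InBox M k → UpperR u v k → v < k
    UpperR⇒< (1≤u , _) (1≤v , _) (_ , k≤M) r =
      +[1+m∸k]≤m⇒< k≤M
        (UpperCell-row₁ 1≤v (1≤1+m∸n k≤M) (UpperCell-antitone ≤-refl 1≤u (1≤1+m∸n k≤M) r))
    exclusive : ∀ {u v k t} → InBox M u → InBox M v → InBox M k → InBox M t →
                UpperR u v k → ¬ UpperR t k v
    exclusive u∈ v∈ k∈ t∈ r r′ = <-asym (UpperR⇒< u∈ v∈ k∈ r) (UpperR⇒< t∈ k∈ v∈ r′)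

≤-extensional : ∀ {x y} → (∀ {k} → 1 ≤ k → k ≤ x → k ≤ y) → (∀ {k} → 1 ≤ k → k ≤ y → k ≤ x) →
                x ≡ y
≤-extensional {zero}  {zero}  _   _   = refl
≤-extensional {zero}  {suc _} _   y⊆x = contradiction (y⊆x (s≤s z≤n) ≤-refl) λ ()
≤-extensional {suc _} {zero}  x⊆y _   = contradiction (x⊆y (s≤s z≤n) ≤-refl) λ ()
≤-extensional {suc _} {suc _} x⊆y y⊆x = ≤-antisym (x⊆y (s≤s z≤n) ≤-refl) (y⊆x (s≤s z≤n) ≤-refl)

toC-inside : ∀ n m a {i j} → 1 ≤ i → i ≤ n + m → 1 ≤ j → j ≤ n + m →
             toC n m a i j ≡ a (i + (n + m)) j ∸ ((n + m) + (i ∸ 1))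
toC-inside n m a (s≤s z≤n) i≤M (s≤s z≤n) j≤M
  rewrite Equivalence.to T-≡ (≤⇒≤ᵇ i≤M) | Equivalence.to T-≡ (≤⇒≤ᵇ j≤M) = refl

toC-outside : ∀ n m a {i j} → 1 ≤ i → 1 ≤ j → ¬ (i ≤ n + m × j ≤ n + m) → toC n m a i j ≡ 0
toC-outside n m a {suc i} {suc j} (s≤s z≤n) (s≤s z≤n) outside
  with suc i ≤ᵇ (n + m) in i≤ᵇM | suc j ≤ᵇ (n + m) in j≤ᵇM
... | true  | true  = contradiction (≤ᵇ⇒≤ (suc i) (n + m) (subst T (sym i≤ᵇM) tt) ,
                                     ≤ᵇ⇒≤ (suc j) (n + m) (subst T (sym j≤ᵇM) tt)) outside
... | true  | false = refl
... | false | _     = refl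

module Preimage (n m : ℕ) (c : ℕ → ℕ → ℕ) (c∈C : InC n m c) where
  open UpperRelationOfC n m c c∈C
  open UpperRelation isUpperRelation
  open Coordinates M

  N : ℕ
  N = 2 * M

  π : ℕ → ℕ → ℕ → Set
  π x y z = Cell UpperR (encode x) (encode y) (encode z)

  a : ℕ → ℕ → ℕ
  a x y = count (λ z → Cell? (encode x) (encode y) (encode z)) N

  π-swap₁₂ : ∀ x y z → π x y z → π y x z
  π-swap₁₂ x y z = Cell-swap₁₂ (encode x) (encode y) (encode z)

  π-swap₂₃ : ∀ x y z → π x y z → π x z y
  π-swap₂₃ x y z = Cell-swap₂₃ (encode x) (encode y) (encode z)

  π-antitone₁ : ∀ {x x′ y z} → InBox N x → InBox N x′ → InBox N y → InBox N z →
                x′ ≤ x → π x y z → π x′ y z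
  π-antitone₁ {x} {x′} {y} {z} x∈ x′∈ y∈ z∈ x′≤x =
    Cell-antitone₁ (encode x) (encode x′) (encode y) (encode z)
      (encode-inBox x∈) (encode-inBox x′∈) (encode-inBox y∈) (encode-inBox z∈) (encode-mono x′≤x)

  π-antitone₂ : ∀ {x y y′ z} → InBox N x → InBox N y → InBox N y′ → InBox N z →
                y′ ≤ y → π x y z → π x y′ z
  π-antitone₂ {x} {y} {y′} {z} x∈ y∈ y′∈ z∈ y′≤y =
    π-swap₁₂ y′ x z ∘′ π-antitone₁ y∈ y′∈ x∈ z∈ y′≤y ∘′ π-swap₁₂ x y z

  π-antitone₃ : ∀ {x y z z′} → InBox N x → InBox N y → InBox N z → InBox N z′ →
                z′ ≤ z → π x y z → π x y z′
  π-antitone₃ {x} {y} {z} {z′} x∈ y∈ z∈ z′∈ z′≤z =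
    π-swap₂₃ x z′ y ∘′ π-antitone₂ x∈ z∈ z′∈ y∈ z′≤z ∘′ π-swap₂₃ x y z

  ≤a⇔π : ∀ {x y z} → InBox N x → InBox N y → InBox N z → (z ≤ a x y ⇔ π x y z)
  ≤a⇔π {x} {y} x∈ y∈ (1≤z , z≤N) = ≤count⇔ _ N downward 1≤z z≤N
    where
    downward : DownwardClosed (π x y) N
    downward 1≤z′ z′≤z z≤N′ =
      π-antitone₃ x∈ y∈ (≤-trans 1≤z′ z′≤z , z≤N′) (1≤z′ , ≤-trans z′≤z z≤N′) z′≤z

  Mem⇒InBox : ∀ {x y z} → Mem N a x y z → InBox N z
  Mem⇒InBox (_ , _ , 1≤z , z≤a) = 1≤z , ≤-trans z≤a (count≤ _ N)

  Mem⇒π : ∀ {x y z} → Mem N a x y z → π x y z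
  Mem⇒π mem@(x∈ , y∈ , _ , z≤a) = to (≤a⇔π x∈ y∈ (Mem⇒InBox mem)) z≤a

  π⇒Mem : ∀ {x y z} → InBox N x → InBox N y → InBox N z → π x y z → Mem N a x y z
  π⇒Mem x∈ y∈ z∈ p = x∈ , y∈ , proj₁ z∈ , from (≤a⇔π x∈ y∈ z∈) p

  a-isPPInBox : IsPPInBox N a
  a-isPPInBox = downward , λ _ _ _ mem → proj₂ (Mem⇒InBox mem)
    where
    downward : ∀ x y z x′ y′ z′ → Mem N a x y z →
               1 ≤ x′ → x′ ≤ x → 1 ≤ y′ → y′ ≤ y → 1 ≤ z′ → z′ ≤ z → Mem N a x′ y′ z′
    downward x y z x′ y′ z′ mem@(x∈ , y∈ , _) 1≤x′ x′≤x 1≤y′ y′≤y 1≤z′ z′≤z =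
      π⇒Mem x′∈ y′∈ z′∈ (π-antitone₃ x′∈ y′∈ z∈ z′∈ z′≤z
                          (π-antitone₂ x′∈ y∈ y′∈ z∈ y′≤y
                            (π-antitone₁ x∈ x′∈ y∈ z∈ x′≤x (Mem⇒π mem))))
      where
      z∈  = Mem⇒InBox mem
      x′∈ = 1≤x′ , ≤-trans x′≤x (proj₂ x∈)
      y′∈ = 1≤y′ , ≤-trans y′≤y (proj₂ y∈)
      z′∈ = 1≤z′ , ≤-trans z′≤z (proj₂ z∈)

  a-totallySymmetric : TotallySymmetric N a
  a-totallySymmetric x y z mem@(x∈ , y∈ , _) =
    π⇒Mem x∈ z∈ y∈ (π-swap₂₃ x y z p) ,
    π⇒Mem y∈ x∈ z∈ yxz ,
    π⇒Mem y∈ z∈ x∈ (π-swap₂₃ y x z yxz) ,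
    π⇒Mem z∈ x∈ y∈ (π-swap₁₂ x z y (π-swap₂₃ x y z p)) ,
    π⇒Mem z∈ y∈ x∈ (π-swap₁₂ y z x (π-swap₂₃ y x z yxz))
    where
    z∈ = Mem⇒InBox mem
    p : π x y z
    p = Mem⇒π mem
    yxz : π y x z
    yxz = π-swap₁₂ x y z p

  π-complement≡ : ∀ {x y z} → InBox N x → InBox N y → InBox N z →
    π (suc N ∸ x) (suc N ∸ y) (suc N ∸ z) ≡
    Cell UpperR (mirror (encode x)) (mirror (encode y)) (mirror (encode z))
  π-complement≡ x∈ y∈ z∈
    rewrite encode-complement x∈ | encode-complement y∈ | encode-complement z∈ = refl

  a-selfComplementary : SelfComplementary N a
  a-selfComplementary x y z x∈ y∈ z∈ = mk⇔
    (λ mem mem′ → Cell⇒¬Cell-mirror (encode x) (encode y) (encode z) (Mem⇒π mem)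
                    (subst id (π-complement≡ x∈ y∈ z∈) (Mem⇒π mem′)))
    (λ ¬mem′ → π⇒Mem x∈ y∈ z∈ (¬Cell-mirror⇒Cell (encode x) (encode y) (encode z) λ cell →
                 ¬mem′ (π⇒Mem (complement-inBox x∈) (complement-inBox y∈) (complement-inBox z∈)
                          (subst id (sym (π-complement≡ x∈ y∈ z∈)) cell))))

  π-upper-lower-upper≡ : ∀ {x y z} → M < x → y ≤ M → M < z →
                         π x y z ≡ UpperCell (x ∸ M) (z ∸ M) y
  π-upper-lower-upper≡ M<x y≤M M<z
    rewrite encode-upper M<x | encode-lower y≤M | encode-upper M<z
          | m∸[m∸n]≡n (m≤n⇒m≤1+n y≤M) = refl

  ¬π-upper-cube : ∀ {x y z} → M < x → M < y → M < z → ¬ π x y z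
  ¬π-upper-cube M<x M<y M<z rewrite encode-upper M<x | encode-upper M<y | encode-upper M<z = λ ()

  π-upper-lower-upper⇒lower≤n : ∀ {x y z} → M < x → 1 ≤ y → y ≤ M → M < z → π x y z → y ≤ n
  π-upper-lower-upper⇒lower≤n M<x 1≤y y≤M M<z p =
    UpperCell⇒col≤n (m<n⇒0<n∸m M<x) (m<n⇒0<n∸m M<z) 1≤y
      (subst id (π-upper-lower-upper≡ M<x y≤M M<z) p)

  a-S-condition : ∀ x y z → Mem N a x y z →
     suc n ≤ x → x ≤ n + 2 * m → suc n ≤ y → y ≤ n + 2 * m → suc n ≤ z → z ≤ n + 2 * m →
     (x ≤ n + m × y ≤ n + m) ⊎ (x ≤ n + m × z ≤ n + m) ⊎ (y ≤ n + m × z ≤ n + m)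
  a-S-condition x y z mem n<x _ n<y _ n<z _ with M <? x | M <? y | M <? z
  ... | no x≮M | no y≮M | _      = inj₁ (≮⇒≥ x≮M , ≮⇒≥ y≮M)
  ... | no x≮M | yes _  | no z≮M = inj₂ (inj₁ (≮⇒≥ x≮M , ≮⇒≥ z≮M))
  ... | yes _  | no y≮M | no z≮M = inj₂ (inj₂ (≮⇒≥ y≮M , ≮⇒≥ z≮M))
  ... | no x≮M | yes M<y | yes M<z = contradiction
        (π-upper-lower-upper⇒lower≤n M<y (≤-trans (s≤s z≤n) n<x) (≮⇒≥ x≮M) M<z
          (π-swap₁₂ x y z (Mem⇒π mem))) (<⇒≱ n<x)
  ... | yes M<x | no y≮M | yes M<z = contradiction
        (π-upper-lower-upper⇒lower≤n M<x (≤-trans (s≤s z≤n) n<y) (≮⇒≥ y≮M) M<z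
          (Mem⇒π mem)) (<⇒≱ n<y)
  ... | yes M<x | yes M<y | no z≮M = contradiction
        (π-upper-lower-upper⇒lower≤n M<x (≤-trans (s≤s z≤n) n<z) (≮⇒≥ z≮M) M<y
          (π-swap₂₃ x y z (Mem⇒π mem))) (<⇒≱ n<z)
  ... | yes M<x | yes M<y | yes M<z = contradiction (Mem⇒π mem) (¬π-upper-cube M<x M<y M<z)

  a∈S : InS n m a
  a∈S = (a-isPPInBox , a-totallySymmetric , a-selfComplementary) , a-S-condition

  π-diagonal≡ : ∀ {i k j} → 1 ≤ k → j ≤ M →
                π (suc i + M) j (M + i + k) ≡ UpperCell (suc i) (i + k) j
  π-diagonal≡ {i} {k} {j} 1≤k j≤M = begin
    π (suc i + M) j (M + i + k)                  ≡⟨ π-upper-lower-upper≡ (m<n+m M {suc i} (s≤s z≤n)) j≤M M<z ⟩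
    UpperCell (suc i + M ∸ M) (M + i + k ∸ M) j  ≡⟨ cong₂ (λ u v → UpperCell u v j) (m+n∸n≡m (suc i) M) z∸M≡ ⟩
    UpperCell (suc i) (i + k) j                  ∎
    where
    open ≡-Reasoning
    M<z : M < M + i + k
    M<z = ≤-trans (m<m+n M 1≤k) (+-monoˡ-≤ k (m≤m+n M i))
    z∸M≡ : M + i + k ∸ M ≡ i + k
    z∸M≡ = trans (cong (_∸ M) (+-assoc M i k)) (m+n∸m≡n M (i + k))

  a-row≡c : ∀ {i j} → suc i ≤ M → 1 ≤ j → j ≤ M → a (suc i + M) j ∸ (M + i) ≡ c (suc i) j
  a-row≡c {i} {j} 1+i≤M 1≤j j≤M = ≤-extensional a⇒c c⇒a
    where
    X∈ : InBox N (suc i + M)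
    X∈ = s≤s z≤n , subst (suc i + M ≤_) (sym (2*m≡m+m M)) (+-monoˡ-≤ M 1+i≤M)
    j∈ : InBox N j
    j∈ = 1≤j , ≤-trans j≤M (subst (M ≤_) (sym (2*m≡m+m M)) (m≤m+n M M))

    a⇒c : ∀ {k} → 1 ≤ k → k ≤ a (suc i + M) j ∸ (M + i) → k ≤ c (suc i) j
    a⇒c {k} 1≤k k≤a∸D =
      to (UpperCell-diagonal⇔ 1≤k) (subst id (π-diagonal≡ 1≤k j≤M) (to (≤a⇔π X∈ j∈ z∈) z≤a))
      where
      z≤a = ≤∸⇒+≤ 1≤k k≤a∸D
      z∈ = ≤-trans 1≤k (m≤n+m k (M + i)) , ≤-trans z≤a (count≤ _ N)

    c⇒a : ∀ {k} → 1 ≤ k → k ≤ c (suc i) j → k ≤ a (suc i + M) j ∸ (M + i)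
    c⇒a {k} 1≤k k≤c = m+n≤o⇒m≤o∸n k (subst (_≤ a (suc i + M) j) (+-comm (M + i) k) z≤a)
      where
      open ≤-Reasoning
      c≢0 : c (suc i) j ≢ 0
      c≢0 = m<n⇒n≢0 (≤-trans 1≤k k≤c)
      z∈ : InBox N (M + i + k)
      z∈ = ≤-trans 1≤k (m≤n+m k (M + i)) , (begin
        M + i + k                  ≡⟨ +-assoc M i k ⟩
        M + (i + k)                ≤⟨ +-monoʳ-≤ M (+-monoʳ-≤ i k≤c) ⟩
        M + (i + c (suc i) j)      ≡⟨ cong (M +_) (+-comm i (c (suc i) j)) ⟩
        M + (c (suc i) j + i)      ≤⟨ +-monoʳ-≤ M (+-monoʳ-≤ (c (suc i) j) (n≤1+n i)) ⟩
        M + (c (suc i) j + suc i)  ≤⟨ +-monoʳ-≤ M (entry+row≤M (s≤s z≤n) 1≤j c≢0) ⟩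
        M + M                      ≡⟨ 2*m≡m+m M ⟨
        N                          ∎)
      z≤a = from (≤a⇔π X∈ j∈ z∈)
              (subst id (sym (π-diagonal≡ 1≤k j≤M)) (from (UpperCell-diagonal⇔ 1≤k) k≤c))

  toC-a≡c : ∀ i j → 1 ≤ i → 1 ≤ j → toC n m a i j ≡ c i j
  toC-a≡c (suc i) j 1≤i 1≤j with (suc i ≤? M) ×-dec (j ≤? M)
  ... | yes (i≤M , j≤M) = trans (toC-inside n m a 1≤i i≤M 1≤j j≤M) (a-row≡c i≤M 1≤j j≤M)
  ... | no outside      = trans (toC-outside n m a 1≤i 1≤j outside) (sym (c-outside 1≤i 1≤j outside))

module PlanePartitionInBox {N : ℕ} {a : ℕ → ℕ → ℕ} (pp : IsPPInBox N a) where

  Mem-downward : ∀ {x y z x′ y′ z′} → Mem N a x y z →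
                 1 ≤ x′ → x′ ≤ x → 1 ≤ y′ → y′ ≤ y → 1 ≤ z′ → z′ ≤ z → Mem N a x′ y′ z′
  Mem-downward = proj₁ pp _ _ _ _ _ _

  Mem⇒InBox : ∀ {x y z} → Mem N a x y z → InBox N z
  Mem⇒InBox {x} {y} {z} mem@(_ , _ , 1≤z , _) = 1≤z , proj₂ pp x y z mem

  height-Mem : ∀ {x y} → InBox N x → InBox N y → 1 ≤ a x y → Mem N a x y (a x y)
  height-Mem x∈ y∈ 1≤a = x∈ , y∈ , 1≤a , ≤-refl

  height-antitone : ∀ {x y x′ y′} → InBox N x → InBox N y →
                    1 ≤ x′ → x′ ≤ x → 1 ≤ y′ → y′ ≤ y → a x y ≤ a x′ y′
  height-antitone {x} {y} x∈ y∈ 1≤x′ x′≤x 1≤y′ y′≤y with a x y ≟ 0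
  ... | yes a≡0 = ≡0⇒≤ a≡0
  ... | no a≢0  = proj₂ (proj₂ (proj₂
        (Mem-downward (height-Mem x∈ y∈ 1≤a) 1≤x′ x′≤x 1≤y′ y′≤y 1≤a ≤-refl)))
    where 1≤a = n≢0⇒n>0 a≢0

  Mem⊆⇒height≤ : ∀ {a′} →
                 (∀ {x y z} → InBox N x → InBox N y → InBox N z → Mem N a x y z → Mem N a′ x y z) →
                 ∀ {x y} → InBox N x → InBox N y → a x y ≤ a′ x y
  Mem⊆⇒height≤ ⊆ {x} {y} x∈ y∈ with a x y ≟ 0
  ... | yes a≡0 = ≡0⇒≤ a≡0
  ... | no a≢0  = proj₂ (proj₂ (proj₂ (⊆ x∈ y∈ (Mem⇒InBox mem) mem)))
    where mem = height-Mem x∈ y∈ (n≢0⇒n>0 a≢0)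

module TotallySymmetricCells {N : ℕ} {a : ℕ → ℕ → ℕ} (ts : TotallySymmetric N a) where

  Mem-swap₁₂ : ∀ {x y z} → Mem N a x y z → Mem N a y x z
  Mem-swap₁₂ mem = proj₁ (proj₂ (ts _ _ _ mem))

  Mem-swap₂₃ : ∀ {x y z} → Mem N a x y z → Mem N a x z y
  Mem-swap₂₃ mem = proj₁ (ts _ _ _ mem)

  Mem-swap₁₃ : ∀ {x y z} → Mem N a x y z → Mem N a z y x
  Mem-swap₁₃ mem = proj₂ (proj₂ (proj₂ (proj₂ (ts _ _ _ mem))))

module TSSCPP {M : ℕ} (1≤M : 1 ≤ M) {a : ℕ → ℕ → ℕ} (a-tsscpp : IsTSSCPP M a) where

  N : ℕ
  N = 2 * M

  pp : IsPPInBox N a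
  pp = proj₁ a-tsscpp

  ts : TotallySymmetric N a
  ts = proj₁ (proj₂ a-tsscpp)

  sc : SelfComplementary N a
  sc = proj₂ (proj₂ a-tsscpp)

  open PlanePartitionInBox pp public
  open TotallySymmetricCells ts public

  M≤N : M ≤ N
  M≤N = subst (M ≤_) (sym (2*m≡m+m M)) (m≤m+n M M)

  Mem? : ∀ {x y z} → InBox N x → InBox N y → 1 ≤ z → Dec (Mem N a x y z)
  Mem? {x} {y} {z} x∈ y∈ 1≤z with z ≤? a x y
  ... | yes z≤a = yes (x∈ , y∈ , 1≤z , z≤a)
  ... | no z≰a  = no λ (_ , _ , _ , z≤a) → z≰a z≤a

  centre∈ : Mem N a M M M
  centre∈ = decidable-stable (Mem? M∈ M∈ 1≤M) λ ¬centre →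
    ¬centre (Mem-downward (opposite∈ ¬centre) 1≤M M≤M′ 1≤M M≤M′ 1≤M M≤M′)
    where
    M∈ = 1≤M , M≤N
    M′∈ = complement-inBox M∈
    M≤M′ = <⇒≤ (complement-lower M ≤-refl)
    opposite∈ : ¬ Mem N a M M M → Mem N a (suc N ∸ M) (suc N ∸ M) (suc N ∸ M)
    opposite∈ ¬centre = decidable-stable (Mem? M′∈ M′∈ (proj₁ M′∈)) λ ¬opposite →
      ¬centre (from (sc M M M M∈ M∈ M∈) ¬opposite)

  lower-cube⊆ : ∀ {x y z} → 1 ≤ x → x ≤ M → 1 ≤ y → y ≤ M → 1 ≤ z → z ≤ M → Mem N a x y z
  lower-cube⊆ = Mem-downward centre∈

  upper-cube-disjoint : ∀ {x y z} → InBox N x → InBox N y → InBox N z →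
                        M < x → M < y → M < z → ¬ Mem N a x y z
  upper-cube-disjoint x∈ y∈ z∈ M<x M<y M<z mem = to (sc _ _ _ x∈ y∈ z∈) mem
    (lower-cube⊆ (proj₁ (complement-inBox x∈)) (complement-upper M M<x)
                 (proj₁ (complement-inBox y∈)) (complement-upper M M<y)
                 (proj₁ (complement-inBox z∈)) (complement-upper M M<z))

  Mem-upper⇒+≤N : ∀ {x y z} → M < x → Mem N a x y z → y + z ≤ N
  Mem-upper⇒+≤N {x} {y} {z} M<x mem@(x∈ , y∈ , _) with y + z ≤? N
  ... | yes y+z≤N = y+z≤N
  ... | no y+z≰N  = ⊥-elim (to (sc x y z x∈ y∈ z∈) mem
    (Mem-downward (Mem-swap₂₃ mem)
      (proj₁ (complement-inBox x∈)) (≤-trans (complement-upper M M<x) (<⇒≤ M<x))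
      (proj₁ (complement-inBox y∈)) (m≤n+o⇒m∸n≤o (suc N) y N<y+z)
      (proj₁ (complement-inBox z∈)) (m≤n+o⇒m∸n≤o (suc N) z (subst (suc N ≤_) (+-comm y z) N<y+z))))
    where
    z∈ = Mem⇒InBox mem
    N<y+z = ≰⇒> y+z≰N

module Image (n m : ℕ) (1≤n : 1 ≤ n) (a : ℕ → ℕ → ℕ) (a∈S : InS n m a) where

  M : ℕ
  M = n + m

  open TSSCPP (≤-trans 1≤n (m≤m+n n m)) (proj₁ a∈S)

  c : ℕ → ℕ → ℕ
  c = toC n m a

  c≢0⇒inside : ∀ {i j} → 1 ≤ i → 1 ≤ j → c i j ≢ 0 → i ≤ M × j ≤ M
  c≢0⇒inside {i} {j} 1≤i 1≤j c≢0 with (i ≤? M) ×-dec (j ≤? M)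
  ... | yes inside = inside
  ... | no outside = contradiction (toC-outside n m a 1≤i 1≤j outside) c≢0

  upper∈ : ∀ {i} → 1 ≤ i → i ≤ M → InBox N (i + M)
  upper∈ {i} 1≤i i≤M =
    ≤-trans 1≤i (m≤m+n i M) , subst (i + M ≤_) (sym (2*m≡m+m M)) (+-monoˡ-≤ M i≤M)

  lower∈ : ∀ {j} → 1 ≤ j → j ≤ M → InBox N j
  lower∈ 1≤j j≤M = 1≤j , ≤-trans j≤M M≤N

  c-antitone : ∀ {i j i′ j′} → 1 ≤ i′ → i′ ≤ i → 1 ≤ j′ → j′ ≤ j → c i j ≤ c i′ j′
  c-antitone {i} {j} {i′} {j′} 1≤i′ i′≤i 1≤j′ j′≤j with (i ≤? M) ×-dec (j ≤? M)
  ... | no outside = ≡0⇒≤ (toC-outside n m a (≤-trans 1≤i′ i′≤i) (≤-trans 1≤j′ j′≤j) outside)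
  ... | yes (i≤M , j≤M) = begin
    c i j                           ≡⟨ toC-inside n m a 1≤i i≤M 1≤j j≤M ⟩
    a (i + M) j ∸ (M + (i ∸ 1))     ≤⟨ ∸-mono a≤ (+-monoʳ-≤ M (∸-monoˡ-≤ 1 i′≤i)) ⟩
    a (i′ + M) j′ ∸ (M + (i′ ∸ 1))  ≡⟨ toC-inside n m a 1≤i′ (≤-trans i′≤i i≤M) 1≤j′ (≤-trans j′≤j j≤M) ⟨
    c i′ j′                         ∎
    where
    open ≤-Reasoning
    1≤i = ≤-trans 1≤i′ i′≤i
    1≤j = ≤-trans 1≤j′ j′≤j
    a≤ : a (i + M) j ≤ a (i′ + M) j′
    a≤ = height-antitone (upper∈ 1≤i i≤M) (lower∈ 1≤j j≤M)
           (≤-trans 1≤i′ (m≤m+n i′ M)) (+-monoˡ-≤ M i′≤i) 1≤j′ j′≤j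

  c≢0⇒Mem : ∀ {i j} → 1 ≤ i → 1 ≤ j → c i j ≢ 0 → Mem N a (i + M) j (M + i)
  c≢0⇒Mem {suc i} {j} 1≤i 1≤j c≢0 =
    upper∈ 1≤i i≤M , lower∈ 1≤j j≤M , ≤-trans 1≤i (m≤n+m (suc i) M) ,
    subst (_≤ a (suc i + M) j) (sym (+-suc M i))
      (m∸n≢0⇒n<m (c≢0 ∘′ trans (toC-inside n m a 1≤i i≤M 1≤j j≤M)))
    where
    i≤M = proj₁ (c≢0⇒inside 1≤i 1≤j c≢0)
    j≤M = proj₂ (c≢0⇒inside 1≤i 1≤j c≢0)

  c-col≤n : ∀ i j → 1 ≤ i → 1 ≤ j → c i j ≢ 0 → j ≤ n
  c-col≤n i j 1≤i 1≤j c≢0 with j ≤? n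
  ... | yes j≤n = j≤n
  ... | no j≰n  = ⊥-elim ([ 1+n≰n ∘′ proj₁ , [ 1+n≰n ∘′ proj₁ , 1+n≰n ∘′ proj₁ ]′ ]′
        (proj₂ a∈S (suc M) (suc M) j corner n<1+M 1+M≤n+2m n<1+M 1+M≤n+2m n<j j≤n+2m))
    where
    open ≤-Reasoning
    j≤M = proj₂ (c≢0⇒inside 1≤i 1≤j c≢0)
    n<j = ≰⇒> j≰n
    n<1+M = s≤s (m≤m+n n m)
    1+M≤n+2m =
      1≤m⇒1+[n+m]≤n+2m (+-cancelˡ-≤ n 1 m (subst (_≤ n + m) (+-comm 1 n) (≤-trans n<j j≤M)))
    j≤n+2m = ≤-trans j≤M (≤-trans (n≤1+n M) 1+M≤n+2m)
    corner : Mem N a (suc M) (suc M) j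
    corner = Mem-swap₂₃ (Mem-downward (c≢0⇒Mem 1≤i 1≤j c≢0) (s≤s z≤n) (+-monoˡ-≤ M 1≤i) 1≤j ≤-refl
                          (s≤s z≤n) (subst (_≤ M + i) (+-comm M 1) (+-monoʳ-≤ M 1≤i)))

  c-column-strict : ∀ i j → 1 ≤ i → 1 ≤ j → c (suc i) j ≢ 0 → c (suc i) j < c i j
  c-column-strict (suc i) j 1≤i 1≤j c≢0 = subst₂ _<_ (sym c₂≡) (sym c₁≡)
    (m∸[1+o]<n∸o (c≢0 ∘′ trans c₂≡)
      (height-antitone (upper∈ (s≤s z≤n) 2+i≤M) (lower∈ 1≤j j≤M)
                       (s≤s z≤n) (+-monoˡ-≤ M (n≤1+n (suc i))) 1≤j ≤-refl))
    where
    2+i≤M = proj₁ (c≢0⇒inside (s≤s z≤n) 1≤j c≢0)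
    j≤M   = proj₂ (c≢0⇒inside (s≤s z≤n) 1≤j c≢0)
    c₂≡ : c (suc (suc i)) j ≡ a (suc (suc i) + M) j ∸ suc (M + i)
    c₂≡ = trans (toC-inside n m a (s≤s z≤n) 2+i≤M 1≤j j≤M)
                (cong (a (suc (suc i) + M) j ∸_) (+-suc M i))
    c₁≡ : c (suc i) j ≡ a (suc i + M) j ∸ (M + i)
    c₁≡ = toC-inside n m a 1≤i (≤-trans (n≤1+n (suc i)) 2+i≤M) 1≤j j≤M

  c-entry+col≤M : ∀ i j → 1 ≤ i → 1 ≤ j → c i j ≢ 0 → c i j + j ≤ M
  c-entry+col≤M (suc i) j 1≤i 1≤j c≢0 = +-cancelˡ-≤ M (c (suc i) j + j) M (begin
    M + (c (suc i) j + j)      ≤⟨ +-monoˡ-≤ (c (suc i) j + j) (m≤m+n M i) ⟩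
    M + i + (c (suc i) j + j)  ≡⟨ +-assoc (M + i) (c (suc i) j) j ⟨
    M + i + c (suc i) j + j    ≡⟨ cong (λ t → M + i + t + j) c≡ ⟩
    M + i + (h ∸ (M + i)) + j  ≡⟨ cong (_+ j) (m+[n∸m]≡n (<⇒≤ M+i<h)) ⟩
    h + j                      ≡⟨ +-comm h j ⟩
    j + h                      ≤⟨ Mem-upper⇒+≤N (m<n+m M {suc i} (s≤s z≤n)) (height-Mem X∈ j∈ (≤-trans (s≤s z≤n) M+i<h)) ⟩
    N                          ≡⟨ 2*m≡m+m M ⟩
    M + M                      ∎)
    where
    open ≤-Reasoning
    i≤M = proj₁ (c≢0⇒inside 1≤i 1≤j c≢0)
    j≤M = proj₂ (c≢0⇒inside 1≤i 1≤j c≢0)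
    X∈ = upper∈ 1≤i i≤M
    j∈ = lower∈ 1≤j j≤M
    h : ℕ
    h = a (suc i + M) j
    c≡ : c (suc i) j ≡ h ∸ (M + i)
    c≡ = toC-inside n m a 1≤i i≤M 1≤j j≤M
    M+i<h : M + i < h
    M+i<h = m∸n≢0⇒n<m (c≢0 ∘′ trans c≡)

  c∈C : InC n m c
  c∈C = ( (λ i j 1≤i 1≤j → c-antitone 1≤i ≤-refl 1≤j (n≤1+n j))
        , (λ i j 1≤i 1≤j → c-antitone 1≤i (n≤1+n i) 1≤j ≤-refl)
        , M , (λ i j → c≢0⇒inside))
      , c-col≤n , c-column-strict , c-entry+col≤M

toC-upper : ∀ n m a {x y} → n + m < x → x ≤ 2 * (n + m) → 1 ≤ y → y ≤ n + m →
            toC n m a (x ∸ (n + m)) y ≡ a x y ∸ (x ∸ 1)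
toC-upper n m a {suc x} {y} M<1+x 1+x≤2M 1≤y y≤M = begin
  toC n m a i y                ≡⟨ toC-inside n m a (m<n⇒0<n∸m M<1+x) i≤M 1≤y y≤M ⟩
  a (i + M) y ∸ (M + (i ∸ 1))  ≡⟨ cong₂ (λ u v → a u y ∸ v) (m∸n+n≡m (<⇒≤ M<1+x)) M+[i∸1]≡x ⟩
  a (suc x) y ∸ x              ∎
  where
  open ≡-Reasoning
  M : ℕ
  M = n + m
  i : ℕ
  i = suc x ∸ M
  i≤M : i ≤ M
  i≤M = m≤n+o⇒m∸n≤o (suc x) M (subst (suc x ≤_) (2*m≡m+m M) 1+x≤2M)
  M+[i∸1]≡x : M + (i ∸ 1) ≡ x
  M+[i∸1]≡x = trans (cong (λ t → M + (t ∸ 1)) (+-∸-assoc 1 M≤x)) (m+[n∸m]≡n M≤x)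
    where M≤x = ≤-pred M<1+x

TwoUpper : ℕ → ℕ → ℕ → ℕ → Set
TwoUpper M x y z = (M < x × M < y × z ≤ M) ⊎ (M < x × y ≤ M × M < z) ⊎ (x ≤ M × M < y × M < z)

module UpperAgreement (n m : ℕ) (1≤n : 1 ≤ n) {a a′ : ℕ → ℕ → ℕ}
  (a-tsscpp : IsTSSCPP (n + m) a) (a′-tsscpp : IsTSSCPP (n + m) a′)
  (toC≡ : ∀ i j → 1 ≤ i → 1 ≤ j → toC n m a i j ≡ toC n m a′ i j) where

  M : ℕ
  M = n + m

  open TSSCPP (≤-trans 1≤n (m≤m+n n m)) a-tsscpp public
  module A′ = TSSCPP (≤-trans 1≤n (m≤m+n n m)) a′-tsscpp

  Mem-along-row : ∀ {x y z} → M < x → y ≤ M → x ≤ z → InBox N x → InBox N y → InBox N z →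
                  Mem N a x y z → Mem N a′ x y z
  Mem-along-row {x} {y} {z} M<x y≤M x≤z x∈ y∈ z∈ (_ , _ , _ , z≤a) =
    x∈ , y∈ , proj₁ z∈ , subst (_≤ a′ x y) (m+[n∸m]≡n (<⇒≤ x∸1<z)) (≤∸⇒+≤ (m<n⇒0<n∸m x∸1<z) (begin
      z ∸ (x ∸ 1)           ≤⟨ ∸-monoˡ-≤ (x ∸ 1) z≤a ⟩
      a x y ∸ (x ∸ 1)       ≡⟨ toC-upper n m a M<x (proj₂ x∈) (proj₁ y∈) y≤M ⟨
      toC n m a (x ∸ M) y   ≡⟨ toC≡ (x ∸ M) y (m<n⇒0<n∸m M<x) (proj₁ y∈) ⟩
      toC n m a′ (x ∸ M) y  ≡⟨ toC-upper n m a′ M<x (proj₂ x∈) (proj₁ y∈) y≤M ⟩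
      a′ x y ∸ (x ∸ 1)      ∎))
    where
    open ≤-Reasoning
    x∸1<z : x ∸ 1 < z
    x∸1<z = <-≤-trans (∸-monoʳ-< (s≤s z≤n) (proj₁ x∈)) x≤z

  Mem-upper-lower-upper : ∀ {x y z} → M < x → y ≤ M → M < z → InBox N x → InBox N y → InBox N z →
                          Mem N a x y z → Mem N a′ x y z
  Mem-upper-lower-upper {x} {y} {z} M<x y≤M M<z x∈ y∈ z∈ mem with x ≤? z
  ... | yes x≤z = Mem-along-row M<x y≤M x≤z x∈ y∈ z∈ mem
  ... | no x≰z  =
    A′.Mem-swap₁₃ (Mem-along-row M<z y≤M (<⇒≤ (≰⇒> x≰z)) z∈ y∈ x∈ (Mem-swap₁₃ mem))

  Mem-TwoUpper : ∀ {x y z} → TwoUpper M x y z → InBox N x → InBox N y → InBox N z →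
                 Mem N a x y z → Mem N a′ x y z
  Mem-TwoUpper (inj₁ (M<x , M<y , z≤M)) x∈ y∈ z∈ =
    A′.Mem-swap₂₃ ∘′ Mem-upper-lower-upper M<x z≤M M<y x∈ z∈ y∈ ∘′ Mem-swap₂₃
  Mem-TwoUpper (inj₂ (inj₁ (M<x , y≤M , M<z))) x∈ y∈ z∈ =
    Mem-upper-lower-upper M<x y≤M M<z x∈ y∈ z∈
  Mem-TwoUpper (inj₂ (inj₂ (x≤M , M<y , M<z))) x∈ y∈ z∈ =
    A′.Mem-swap₁₂ ∘′ Mem-upper-lower-upper M<y x≤M M<z y∈ x∈ z∈ ∘′ Mem-swap₁₂

module Injectivity (n m : ℕ) (1≤n : 1 ≤ n) {a a′ : ℕ → ℕ → ℕ}
  (a-tsscpp : IsTSSCPP (n + m) a) (a′-tsscpp : IsTSSCPP (n + m) a′)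
  (toC≡ : ∀ i j → 1 ≤ i → 1 ≤ j → toC n m a i j ≡ toC n m a′ i j) where

  open UpperAgreement n m 1≤n a-tsscpp a′-tsscpp toC≡
  module Back =
    UpperAgreement n m 1≤n a′-tsscpp a-tsscpp (λ i j 1≤i 1≤j → sym (toC≡ i j 1≤i 1≤j))

  Mem-OneUpper : ∀ {x y z} → TwoUpper M (suc N ∸ x) (suc N ∸ y) (suc N ∸ z) →
                 InBox N x → InBox N y → InBox N z → Mem N a x y z → Mem N a′ x y z
  Mem-OneUpper two x∈ y∈ z∈ mem = from (A′.sc _ _ _ x∈ y∈ z∈) λ opposite′ →
    to (sc _ _ _ x∈ y∈ z∈) mem
      (Back.Mem-TwoUpper two (complement-inBox x∈) (complement-inBox y∈) (complement-inBox z∈) opposite′)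

  Mem⊆ : ∀ {x y z} → InBox N x → InBox N y → InBox N z → Mem N a x y z → Mem N a′ x y z
  Mem⊆ {x} {y} {z} x∈ y∈ z∈ mem with M <? x | M <? y | M <? z
  ... | no x≮M | no y≮M | no z≮M =
    A′.lower-cube⊆ (proj₁ x∈) (≮⇒≥ x≮M) (proj₁ y∈) (≮⇒≥ y≮M) (proj₁ z∈) (≮⇒≥ z≮M)
  ... | yes M<x | yes M<y | yes M<z = ⊥-elim (upper-cube-disjoint x∈ y∈ z∈ M<x M<y M<z mem)
  ... | yes M<x | yes M<y | no z≮M = Mem-TwoUpper (inj₁ (M<x , M<y , ≮⇒≥ z≮M)) x∈ y∈ z∈ mem
  ... | yes M<x | no y≮M | yes M<z = Mem-TwoUpper (inj₂ (inj₁ (M<x , ≮⇒≥ y≮M , M<z))) x∈ y∈ z∈ mem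
  ... | no x≮M | yes M<y | yes M<z = Mem-TwoUpper (inj₂ (inj₂ (≮⇒≥ x≮M , M<y , M<z))) x∈ y∈ z∈ mem
  ... | yes M<x | no y≮M | no z≮M = Mem-OneUpper
        (inj₂ (inj₂ (complement-upper M M<x , complement-lower M (≮⇒≥ y≮M) , complement-lower M (≮⇒≥ z≮M))))
        x∈ y∈ z∈ mem
  ... | no x≮M | yes M<y | no z≮M = Mem-OneUpper
        (inj₂ (inj₁ (complement-lower M (≮⇒≥ x≮M) , complement-upper M M<y , complement-lower M (≮⇒≥ z≮M))))
        x∈ y∈ z∈ mem
  ... | no x≮M | no y≮M | yes M<z = Mem-OneUpper
        (inj₁ (complement-lower M (≮⇒≥ x≮M) , complement-lower M (≮⇒≥ y≮M) , complement-upper M M<z))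
        x∈ y∈ z∈ mem

toC-injective : ∀ n m → 1 ≤ n → ∀ {a a′} → IsTSSCPP (n + m) a → IsTSSCPP (n + m) a′ →
  (∀ i j → 1 ≤ i → 1 ≤ j → toC n m a i j ≡ toC n m a′ i j) →
  ∀ i j → InBox (2 * (n + m)) i → InBox (2 * (n + m)) j → a i j ≡ a′ i j
toC-injective n m 1≤n a-tsscpp a′-tsscpp toC≡ i j i∈ j∈ = ≤-antisym
  (Mem⊆⇒height≤ (proj₁ a-tsscpp) (Injectivity.Mem⊆ n m 1≤n a-tsscpp a′-tsscpp toC≡) i∈ j∈)
  (Mem⊆⇒height≤ (proj₁ a′-tsscpp)
    (Injectivity.Mem⊆ n m 1≤n a′-tsscpp a-tsscpp (λ i j 1≤i 1≤j → sym (toC≡ i j 1≤i 1≤j))) i∈ j∈)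
  where open PlanePartitionInBox using (Mem⊆⇒height≤)

theorem3p5 : ∀ (m n : ℕ) → 1 ≤ n →
  -- the image of every element of S_{n,m} lies in C_{n,m}
  (∀ a → InS n m a → InC n m (toC n m a))
  -- injectivity (arrays compared on their index ranges)
  × (∀ a a′ → InS n m a → InS n m a′ →
       (∀ i j → 1 ≤ i → 1 ≤ j → toC n m a i j ≡ toC n m a′ i j) →
       ∀ i j → InBox (2 * (n + m)) i → InBox (2 * (n + m)) j → a i j ≡ a′ i j)
  -- surjectivity onto C_{n,m}
  × (∀ c → InC n m c →
       ∃ λ a → InS n m a × (∀ i j → 1 ≤ i → 1 ≤ j → toC n m a i j ≡ c i j))
theorem3p5 m n 1≤n =
    (λ a a∈S → Image.c∈C n m 1≤n a a∈S)
  , (λ a a′ a∈S a′∈S → toC-injective n m 1≤n (proj₁ a∈S) (proj₁ a′∈S))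
  , (λ c c∈C → Preimage.a n m c c∈C , Preimage.a∈S n m c c∈C , Preimage.toC-a≡c n m c c∈C)
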